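{- Let $H=(V,E)$ be a $d$-regular graph, let $E'\subseteq E$, and let $v(e)\in\mathbb{Z}_2^d$ be assigned to each edge $e\in E'$. Suppose that for every vertex $u$ the family of vectors $v(e)$ assigned to the edges of $E'$ incident with $u$ is linearly independent. Then it is possible to assign a vector $v(e)\in\mathbb{Z}_2^d$ to every edge $e\in E\setminus E'$ so that for every vertex $u$, the family of vectors $v(e)$ assigned to all $d$ edges incident with $u$ forms a basis of $\mathbb{Z}_2^d$.
   Context: Graphs are finite and simple. A family of vectors indexed by edges is linearly independent if no nontrivial $\mathbb{Z}_2$-combination of them is zero (in particular two distinct edges at a vertex may not receive equal vectors). -}

module Defs where

open import Data.Nat using (ℕ; zero; suc; _+_)
open import Data.Bool using (Bool; true; false; _∧_; _xor_; if_then_else_)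
open import Data.Fin using (Fin; zero; suc)
open import Data.Vec using (Vec; replicate; zipWith)
open import Data.Product using (∃; _×_)
open import Relation.Binary.PropositionalEquality using (_≡_)

-- Z₂ is Bool with xor as addition; Z₂^d is Vec Bool d.
Z2^ : ℕ → Set
Z2^ d = Vec Bool d

0v : ∀ {d} → Z2^ d
0v {d} = replicate d false

_⊕_ : ∀ {d} → Z2^ d → Z2^ d → Z2^ d
_⊕_ = zipWith _xor_

record Graph (n : ℕ) : Set where
  field
    adj     : Fin n → Fin n → Bool
    adj-sym : ∀ i j → adj i j ≡ adj j i
    irrefl  : ∀ i → adj i i ≡ false
open Graph public

count : ∀ {n} → (Fin n → Bool) → ℕ
count {zero}  P = 0
count {suc n} P = (if P zero then 1 else 0) + count (λ j → P (suc j))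

degree : ∀ {n} → Graph n → Fin n → ℕ
degree G u = count (adj G u)

Regular : ∀ {n} → ℕ → Graph n → Set
Regular d G = ∀ u → degree G u ≡ d

-- Z₂-linear combination  Σ_{j ∈ S, c j = 1} f j  of a family f indexed
-- by the subset S ⊆ Fin n.
combo : ∀ {n d} → (S : Fin n → Bool) → (c : Fin n → Bool) → (f : Fin n → Z2^ d) → Z2^ d
combo {zero}  S c f = 0v
combo {suc n} S c f =
  (if S zero ∧ c zero then f zero ⊕ rest else rest)
  where rest = combo (λ j → S (suc j)) (λ j → c (suc j)) (λ j → f (suc j))

LinIndep : ∀ {n d} → (Fin n → Bool) → (Fin n → Z2^ d) → Set
LinIndep S f = ∀ c → combo S c f ≡ 0v → ∀ j → S j ≡ true → c j ≡ false

Spans : ∀ {n d} → (Fin n → Bool) → (Fin n → Z2^ d) → Set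
Spans {d = d} S f = ∀ (w : Z2^ d) → ∃ λ c → combo S c f ≡ w

IsBasis : ∀ {n d} → (Fin n → Bool) → (Fin n → Z2^ d) → Set
IsBasis S f = LinIndep S f × Spans S f

{-# OPTIONS --safe #-}
module Submission where

-- Label the edges outside E′ one at a time. If the edge ij is still unlabelled, the labels
-- already present at i and at j are independent families of fewer than d vectors; an
-- independent family of k vectors spans exactly 2^k vectors, so the two spans have at most
-- 2^(d-1) elements each and share 0, and some x lies outside both. Labelling ij by x keeps
-- both families independent. When every edge is labelled, each vertex carries d independent
-- vectors, and these span Z₂^d because their span has 2^d elements.

open import Defs
open import Algebra.Bundles using (CommutativeSemigroup)
import Algebra.Properties.CommutativeSemigroup as CommutativeSemigroupProperties
open import Data.Bool using (Bool; true; false; _∧_; _∨_; _xor_; not; if_then_else_)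
open import Data.Bool.Properties
  using ( xor-assoc; xor-comm; xor-identityˡ; ∧-distribˡ-xor; ∧-zeroʳ; ∨-zeroʳ
        ; ∨-conicalˡ; ∨-conicalʳ; not-involutive)
open import Data.Empty using (⊥-elim)
open import Data.Fin using (Fin; zero; suc; _≟_)
open import Data.List using (List; []; _∷_; cartesianProduct; allFin)
open import Data.List.Membership.Propositional using (_∈_)
open import Data.List.Membership.Propositional.Properties using (∈-cartesianProduct⁺; ∈-allFin)
open import Data.List.Relation.Unary.Any using (here; there)
open import Data.Nat using (ℕ; zero; suc; _+_; _^_; _≤_; _<_; z≤n; s≤s)
open import Data.Nat.Properties
  using ( +-identityʳ; +-comm; +-cancelˡ-≡; +-mono-≤; ^-monoʳ-≤; ≤-trans; <-irrefl
        ; m≤m+n; m≤n+m; m<m+n; m≤n⇒m≤1+n; +-commutativeSemigroup; module ≤-Reasoning)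
open import Data.Product using (∃; _×_; _,_)
open import Data.Sum using (_⊎_; inj₁; inj₂)
open import Data.Vec using ([]; _∷_)
open import Data.Vec.Properties using (zipWith-assoc; zipWith-comm; zipWith-identityˡ)
open import Data.Vec.Functional using (tail; updateAt) renaming (_∷_ to _∷ᶠ_)
open import Data.Vec.Functional.Properties using (updateAt-updates; updateAt-minimal)
open import Function using (_∘_)
open import Relation.Binary.PropositionalEquality
open import Relation.Binary.PropositionalEquality.Algebra using (isMagma)
open import Relation.Nullary using (Dec; yes; no; ¬_; contradiction; _×-dec_; _⊎-dec_)

open CommutativeSemigroupProperties +-commutativeSemigroup
  using () renaming (interchange to +-interchange)

private
  variable
    n m d : ℕ

⊕-assoc : (x y z : Z2^ d) → (x ⊕ y) ⊕ z ≡ x ⊕ (y ⊕ z)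
⊕-assoc = zipWith-assoc xor-assoc

⊕-comm : (x y : Z2^ d) → x ⊕ y ≡ y ⊕ x
⊕-comm = zipWith-comm xor-comm

⊕-identityˡ : (x : Z2^ d) → 0v ⊕ x ≡ x
⊕-identityˡ = zipWith-identityˡ xor-identityˡ

⊕-identityʳ : (x : Z2^ d) → x ⊕ 0v ≡ x
⊕-identityʳ x = trans (⊕-comm x 0v) (⊕-identityˡ x)

⊕-self : (x : Z2^ d) → x ⊕ x ≡ 0v
⊕-self []          = refl
⊕-self (false ∷ x) = cong (false ∷_) (⊕-self x)
⊕-self (true ∷ x)  = cong (false ∷_) (⊕-self x)

⊕-cancelˡ : (x y : Z2^ d) → x ⊕ (x ⊕ y) ≡ y
⊕-cancelˡ x y = begin
  x ⊕ (x ⊕ y) ≡⟨ ⊕-assoc x x y ⟨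
  (x ⊕ x) ⊕ y ≡⟨ cong (_⊕ y) (⊕-self x) ⟩
  0v ⊕ y      ≡⟨ ⊕-identityˡ y ⟩
  y           ∎
  where open ≡-Reasoning

⊕-cancelʳ : (x y : Z2^ d) → (x ⊕ y) ⊕ y ≡ x
⊕-cancelʳ x y = begin
  (x ⊕ y) ⊕ y ≡⟨ ⊕-assoc x y y ⟩
  x ⊕ (y ⊕ y) ≡⟨ cong (x ⊕_) (⊕-self y) ⟩
  x ⊕ 0v      ≡⟨ ⊕-identityʳ x ⟩
  x           ∎
  where open ≡-Reasoning

⊕≡0v⇒≡ : (x y : Z2^ d) → x ⊕ y ≡ 0v → x ≡ y
⊕≡0v⇒≡ x y eq = begin
  x            ≡⟨ ⊕-identityʳ x ⟨
  x ⊕ 0v       ≡⟨ cong (x ⊕_) eq ⟨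
  x ⊕ (x ⊕ y)  ≡⟨ ⊕-cancelˡ x y ⟩
  y            ∎
  where open ≡-Reasoning

⊕-commutativeSemigroup : ℕ → CommutativeSemigroup _ _
⊕-commutativeSemigroup d = record
  { Carrier                = Z2^ d
  ; _≈_                    = _≡_
  ; _∙_                    = _⊕_
  ; isCommutativeSemigroup = record
    { isSemigroup = record { isMagma = isMagma _⊕_ ; assoc = ⊕-assoc }
    ; comm        = ⊕-comm
    }
  }

⊕-interchange : (w x y z : Z2^ d) → (w ⊕ x) ⊕ (y ⊕ z) ≡ (w ⊕ y) ⊕ (x ⊕ z)
⊕-interchange {d} = CommutativeSemigroupProperties.interchange (⊕-commutativeSemigroup d)

⊕-leftComm : (x y z : Z2^ d) → x ⊕ (y ⊕ z) ≡ y ⊕ (x ⊕ z)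
⊕-leftComm {d} = CommutativeSemigroupProperties.x∙yz≈y∙xz (⊕-commutativeSemigroup d)

infixr 25 _·_

_·_ : Bool → Z2^ d → Z2^ d
b · x = if b then x else 0v

·-distribʳ-xor : ∀ a b (x : Z2^ d) → (a xor b) · x ≡ a · x ⊕ b · x
·-distribʳ-xor false false x = sym (⊕-identityˡ 0v)
·-distribʳ-xor false true  x = sym (⊕-identityˡ x)
·-distribʳ-xor true  false x = sym (⊕-identityʳ x)
·-distribʳ-xor true  true  x = sym (⊕-self x)

combo-step : (S c : Fin (suc n) → Bool) (f : Fin (suc n) → Z2^ d) →
  combo S c f ≡ (S zero ∧ c zero) · f zero ⊕ combo (tail S) (tail c) (tail f)
combo-step S c f with S zero ∧ c zero
... | true  = refl
... | false = sym (⊕-identityˡ _)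

combo-cong : (S T c : Fin n → Bool) (f : Fin n → Z2^ d) →
  (∀ k → S k ≡ T k) → combo S c f ≡ combo T c f
combo-cong {zero}  S T c f S≗T = refl
combo-cong {suc n} S T c f S≗T = begin
  combo S c f
    ≡⟨ combo-step S c f ⟩
  (S zero ∧ c zero) · f zero ⊕ combo (tail S) (tail c) (tail f)
    ≡⟨ cong₂ (λ b r → (b ∧ c zero) · f zero ⊕ r) (S≗T zero)
             (combo-cong (tail S) (tail T) (tail c) (tail f) (λ k → S≗T (suc k))) ⟩
  (T zero ∧ c zero) · f zero ⊕ combo (tail T) (tail c) (tail f)
    ≡⟨ combo-step T c f ⟨
  combo T c f
    ∎
  where open ≡-Reasoning

combo-xor : (S c c′ : Fin n → Bool) (f : Fin n → Z2^ d) →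
  combo S (λ k → c k xor c′ k) f ≡ combo S c f ⊕ combo S c′ f
combo-xor {zero}  S c c′ f = sym (⊕-identityˡ 0v)
combo-xor {suc n} S c c′ f = begin
  combo S (λ k → c k xor c′ k) f
    ≡⟨ combo-step S (λ k → c k xor c′ k) f ⟩
  (S zero ∧ (c zero xor c′ zero)) · f zero
    ⊕ combo (tail S) (λ k → c (suc k) xor c′ (suc k)) (tail f)
    ≡⟨ cong₂ _⊕_ scalar-part (combo-xor (tail S) (tail c) (tail c′) (tail f)) ⟩
  (a · f zero ⊕ a′ · f zero) ⊕ (r ⊕ r′)
    ≡⟨ ⊕-interchange (a · f zero) (a′ · f zero) r r′ ⟩
  (a · f zero ⊕ r) ⊕ (a′ · f zero ⊕ r′)
    ≡⟨ cong₂ _⊕_ (combo-step S c f) (combo-step S c′ f) ⟨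
  combo S c f ⊕ combo S c′ f
    ∎
  where
  open ≡-Reasoning
  a a′ : Bool
  a  = S zero ∧ c zero
  a′ = S zero ∧ c′ zero
  r r′ : Z2^ _
  r  = combo (tail S) (tail c) (tail f)
  r′ = combo (tail S) (tail c′) (tail f)
  scalar-part : (S zero ∧ (c zero xor c′ zero)) · f zero ≡ a · f zero ⊕ a′ · f zero
  scalar-part = trans (cong (_· f zero) (∧-distribˡ-xor (S zero) (c zero) (c′ zero)))
                      (·-distribʳ-xor a a′ (f zero))

combo-false∷ : (S : Fin (suc n) → Bool) (c : Fin n → Bool) (f : Fin (suc n) → Z2^ d) →
  combo S (false ∷ᶠ c) f ≡ combo (tail S) c (tail f)
combo-false∷ S c f =
  trans (combo-step S (false ∷ᶠ c) f)
        (trans (cong (λ b → b · f zero ⊕ combo (tail S) c (tail f)) (∧-zeroʳ (S zero)))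
               (⊕-identityˡ _))

combo-true∷ : (S : Fin (suc n) → Bool) (c : Fin n → Bool) (f : Fin (suc n) → Z2^ d) →
  S zero ≡ true → combo S (true ∷ᶠ c) f ≡ f zero ⊕ combo (tail S) c (tail f)
combo-true∷ S c f S₀ =
  trans (combo-step S (true ∷ᶠ c) f)
        (cong (λ b → (b ∧ true) · f zero ⊕ combo (tail S) c (tail f)) S₀)

isZero : Z2^ d → Bool
isZero []      = true
isZero (b ∷ x) = not b ∧ isZero x

isZero-0v : isZero (0v {d}) ≡ true
isZero-0v {zero}  = refl
isZero-0v {suc d} = isZero-0v {d}

isZero⇒≡0v : (x : Z2^ d) → isZero x ≡ true → x ≡ 0v
isZero⇒≡0v []          _ = refl
isZero⇒≡0v (false ∷ x) h = cong (false ∷_) (isZero⇒≡0v x h)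

inSpan : (Fin n → Bool) → (Fin n → Z2^ d) → Z2^ d → Bool
inSpan {zero}  S f x = isZero x
inSpan {suc n} S f x =
  (S zero ∧ inSpan (tail S) (tail f) (f zero ⊕ x)) ∨ inSpan (tail S) (tail f) x

inSpan-sound : (S : Fin n → Bool) (f : Fin n → Z2^ d) (x : Z2^ d) →
  inSpan S f x ≡ true → ∃ λ c → combo S c f ≡ x
inSpan-sound {zero} S f x h = (λ _ → false) , sym (isZero⇒≡0v x h)
inSpan-sound {suc n} S f x h with S zero | inSpan (tail S) (tail f) (f zero ⊕ x) in shifted
... | true | true =
  let c , eq = inSpan-sound (tail S) (tail f) (f zero ⊕ x) shifted
  in true ∷ᶠ c , trans (cong (f zero ⊕_) eq) (⊕-cancelˡ (f zero) x)
... | true  | false = let c , eq = inSpan-sound (tail S) (tail f) x h in false ∷ᶠ c , eq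
... | false | _     = let c , eq = inSpan-sound (tail S) (tail f) x h in false ∷ᶠ c , eq

inSpan-complete : (S c : Fin n → Bool) (f : Fin n → Z2^ d) → inSpan S f (combo S c f) ≡ true
inSpan-complete {zero} {d} S c f = isZero-0v {d}
inSpan-complete {suc n} S c f with S zero | c zero
... | true  | true  =
  cong (_∨ A (f zero ⊕ r))
       (trans (cong A (⊕-cancelˡ (f zero) r)) (inSpan-complete (tail S) (tail c) (tail f)))
  where
  A : Z2^ _ → Bool
  A = inSpan (tail S) (tail f)
  r : Z2^ _
  r = combo (tail S) (tail c) (tail f)
... | true  | false =
  trans (cong (A (f zero ⊕ r) ∨_) (inSpan-complete (tail S) (tail c) (tail f))) (∨-zeroʳ _)
  where
  A : Z2^ _ → Bool
  A = inSpan (tail S) (tail f)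
  r : Z2^ _
  r = combo (tail S) (tail c) (tail f)
... | false | _     = inSpan-complete (tail S) (tail c) (tail f)

inSpan-0v : (S : Fin n → Bool) (f : Fin n → Z2^ d) → inSpan S f 0v ≡ true
inSpan-0v {zero} {d} S f = isZero-0v {d}
inSpan-0v {suc n} S f =
  trans (cong (S zero ∧ inSpan (tail S) (tail f) (f zero ⊕ 0v) ∨_) (inSpan-0v (tail S) (tail f)))
        (∨-zeroʳ _)

inSpan-⊕ : (S : Fin n → Bool) (f : Fin n → Z2^ d) {x y : Z2^ d} →
  inSpan S f x ≡ true → inSpan S f y ≡ true → inSpan S f (x ⊕ y) ≡ true
inSpan-⊕ S f x∈ y∈ =
  let c , cx = inSpan-sound S f _ x∈
      c′ , cy = inSpan-sound S f _ y∈
  in subst (λ z → inSpan S f z ≡ true) (trans (combo-xor S c c′ f) (cong₂ _⊕_ cx cy))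
           (inSpan-complete S (λ k → c k xor c′ k) f)

LinIndep-cong : {S T : Fin n → Bool} {f : Fin n → Z2^ d} →
  (∀ k → S k ≡ T k) → LinIndep S f → LinIndep T f
LinIndep-cong {S = S} {T} {f} S≗T ind c eq j Tj =
  ind c (trans (combo-cong S T c f S≗T) eq) j (trans (S≗T j) Tj)

LinIndep-tail : {S : Fin (suc n) → Bool} {f : Fin (suc n) → Z2^ d} →
  LinIndep S f → LinIndep (tail S) (tail f)
LinIndep-tail {S = S} {f} ind c eq j =
  ind (false ∷ᶠ c) (trans (combo-false∷ S c f) eq) (suc j)

LinIndep-head∉span : {S : Fin (suc n) → Bool} {f : Fin (suc n) → Z2^ d} →
  LinIndep S f → S zero ≡ true → inSpan (tail S) (tail f) (f zero) ≡ false
LinIndep-head∉span {S = S} {f} ind S₀ with inSpan (tail S) (tail f) (f zero) in f₀∈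
... | false = refl
... | true with c , eq ← inSpan-sound (tail S) (tail f) (f zero) f₀∈
  with () ← ind (true ∷ᶠ c) (trans (combo-true∷ S c f S₀) (trans (cong (f zero ⊕_) eq) (⊕-self (f zero))))
                zero S₀

combo-updateAt : (S c : Fin n → Bool) (f : Fin n → Z2^ d) (j : Fin n) (x : Z2^ d) → S j ≡ false →
  combo (updateAt S j (λ _ → true)) c (updateAt f j (λ _ → x)) ≡ c j · x ⊕ combo S c f
combo-updateAt S c f zero x S₀ = begin
  combo (updateAt S zero (λ _ → true)) c (updateAt f zero (λ _ → x))
    ≡⟨ combo-step (updateAt S zero (λ _ → true)) c (updateAt f zero (λ _ → x)) ⟩
  c zero · x ⊕ r
    ≡⟨ cong (c zero · x ⊕_) (⊕-identityˡ r) ⟨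
  c zero · x ⊕ (false · f zero ⊕ r)
    ≡⟨ cong (λ b → c zero · x ⊕ ((b ∧ c zero) · f zero ⊕ r)) S₀ ⟨
  c zero · x ⊕ ((S zero ∧ c zero) · f zero ⊕ r)
    ≡⟨ cong (c zero · x ⊕_) (combo-step S c f) ⟨
  c zero · x ⊕ combo S c f
    ∎
  where
  open ≡-Reasoning
  r : Z2^ _
  r = combo (tail S) (tail c) (tail f)
combo-updateAt S c f (suc j) x Sj = begin
  combo (updateAt S (suc j) (λ _ → true)) c (updateAt f (suc j) (λ _ → x))
    ≡⟨ combo-step (updateAt S (suc j) (λ _ → true)) c (updateAt f (suc j) (λ _ → x)) ⟩
  a · f zero ⊕ combo (updateAt (tail S) j (λ _ → true)) (tail c) (updateAt (tail f) j (λ _ → x))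
    ≡⟨ cong (a · f zero ⊕_) (combo-updateAt (tail S) (tail c) (tail f) j x Sj) ⟩
  a · f zero ⊕ (c (suc j) · x ⊕ combo (tail S) (tail c) (tail f))
    ≡⟨ ⊕-leftComm (a · f zero) (c (suc j) · x) _ ⟩
  c (suc j) · x ⊕ (a · f zero ⊕ combo (tail S) (tail c) (tail f))
    ≡⟨ cong (c (suc j) · x ⊕_) (combo-step S c f) ⟨
  c (suc j) · x ⊕ combo S c f
    ∎
  where
  open ≡-Reasoning
  a : Bool
  a = S zero ∧ c zero

LinIndep-insert : {S : Fin n → Bool} {f : Fin n → Z2^ d} {j : Fin n} {x : Z2^ d} →
  LinIndep S f → S j ≡ false → inSpan S f x ≡ false →
  LinIndep (updateAt S j (λ _ → true)) (updateAt f j (λ _ → x))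
LinIndep-insert {S = S} {f} {j} {x} ind Sj x∉ c eq = coefficients-vanish
  where
  decomposed : c j · x ⊕ combo S c f ≡ 0v
  decomposed = trans (sym (combo-updateAt S c f j x Sj)) eq

  x∈ : c j ≡ true → inSpan S f x ≡ true
  x∈ cj = subst (λ z → inSpan S f z ≡ true)
                (sym (⊕≡0v⇒≡ x _ (subst (λ b → b · x ⊕ combo S c f ≡ 0v) cj decomposed)))
                (inSpan-complete S c f)

  cj≡false : c j ≡ false
  cj≡false with c j in cj
  ... | false = refl
  ... | true with () ← trans (sym (x∈ cj)) x∉

  combo≡0v : combo S c f ≡ 0v
  combo≡0v = trans (sym (⊕-identityˡ _)) (subst (λ b → b · x ⊕ combo S c f ≡ 0v) cj≡false decomposed)

  coefficients-vanish : ∀ k → updateAt S j (λ _ → true) k ≡ true → c k ≡ false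
  coefficients-vanish k k∈ with k ≟ j
  ... | yes refl = cj≡false
  ... | no k≢j   = ind c combo≡0v k (trans (sym (updateAt-minimal k j S k≢j)) k∈)

countVec : (Z2^ d → Bool) → ℕ
countVec {zero}  P = if P [] then 1 else 0
countVec {suc d} P = countVec (λ x → P (false ∷ x)) + countVec (λ x → P (true ∷ x))

2^[1+d]≡2^d+2^d : ∀ d → 2 ^ suc d ≡ 2 ^ d + 2 ^ d
2^[1+d]≡2^d+2^d d = cong (2 ^ d +_) (+-identityʳ (2 ^ d))

countVec-complement : (P : Z2^ d → Bool) → countVec P + countVec (λ x → not (P x)) ≡ 2 ^ d
countVec-complement {zero} P with P []
... | true  = refl
... | false = refl
countVec-complement {suc d} P = begin
  (countVec P₀ + countVec P₁) + (countVec (λ x → not (P₀ x)) + countVec (λ x → not (P₁ x)))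
    ≡⟨ +-interchange (countVec P₀) _ _ _ ⟩
  (countVec P₀ + countVec (λ x → not (P₀ x))) + (countVec P₁ + countVec (λ x → not (P₁ x)))
    ≡⟨ cong₂ _+_ (countVec-complement P₀) (countVec-complement P₁) ⟩
  2 ^ d + 2 ^ d
    ≡⟨ 2^[1+d]≡2^d+2^d d ⟨
  2 ^ suc d
    ∎
  where
  open ≡-Reasoning
  P₀ P₁ : Z2^ d → Bool
  P₀ x = P (false ∷ x)
  P₁ x = P (true ∷ x)

countVec-∨-∧ : (P Q : Z2^ d → Bool) →
  countVec (λ x → P x ∨ Q x) + countVec (λ x → P x ∧ Q x) ≡ countVec P + countVec Q
countVec-∨-∧ {zero} P Q with P [] | Q []
... | true  | true  = refl
... | true  | false = refl
... | false | true  = refl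
... | false | false = refl
countVec-∨-∧ {suc d} P Q = begin
  (countVec (∨at false) + countVec (∨at true)) + (countVec (∧at false) + countVec (∧at true))
    ≡⟨ +-interchange (countVec (∨at false)) _ _ _ ⟩
  (countVec (∨at false) + countVec (∧at false)) + (countVec (∨at true) + countVec (∧at true))
    ≡⟨ cong₂ _+_ (countVec-∨-∧ (at P false) (at Q false))
                 (countVec-∨-∧ (at P true) (at Q true)) ⟩
  (countVec (at P false) + countVec (at Q false)) + (countVec (at P true) + countVec (at Q true))
    ≡⟨ +-interchange (countVec (at P false)) _ _ _ ⟩
  (countVec (at P false) + countVec (at P true)) + (countVec (at Q false) + countVec (at Q true))
    ∎
  where
  open ≡-Reasoning
  at : (Z2^ (suc d) → Bool) → Bool → Z2^ d → Bool
  at R b x = R (b ∷ x)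
  ∨at ∧at : Bool → Z2^ d → Bool
  ∨at b x = P (b ∷ x) ∨ Q (b ∷ x)
  ∧at b x = P (b ∷ x) ∧ Q (b ∷ x)

countVec-translate : (P : Z2^ d → Bool) (a : Z2^ d) → countVec (λ x → P (a ⊕ x)) ≡ countVec P
countVec-translate P [] = refl
countVec-translate P (false ∷ a) =
  cong₂ _+_ (countVec-translate (λ x → P (false ∷ x)) a)
            (countVec-translate (λ x → P (true ∷ x)) a)
countVec-translate P (true ∷ a) =
  trans (cong₂ _+_ (countVec-translate (λ x → P (true ∷ x)) a)
                   (countVec-translate (λ x → P (false ∷ x)) a))
        (+-comm (countVec (λ x → P (true ∷ x))) _)

countVec-empty : (P : Z2^ d → Bool) → (∀ x → P x ≡ false) → countVec P ≡ 0
countVec-empty {zero} P P≡false rewrite P≡false [] = refl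
countVec-empty {suc d} P P≡false =
  cong₂ _+_ (countVec-empty _ (λ x → P≡false (false ∷ x)))
            (countVec-empty _ (λ x → P≡false (true ∷ x)))

countVec-hit : (P : Z2^ d → Bool) (x : Z2^ d) → P x ≡ true → 0 < countVec P
countVec-hit P [] Px rewrite Px = s≤s z≤n
countVec-hit P (false ∷ x) Px = ≤-trans (countVec-hit (λ y → P (false ∷ y)) x Px) (m≤m+n _ _)
countVec-hit P (true ∷ x)  Px = ≤-trans (countVec-hit (λ y → P (true ∷ y)) x Px) (m≤n+m _ _)

countVec-witness : (P : Z2^ d → Bool) → 0 < countVec P → ∃ λ x → P x ≡ true
countVec-witness {zero} P pos with P [] in P[]
... | true = [] , P[]
countVec-witness {suc d} P pos with countVec (λ x → P (false ∷ x)) in count₀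
... | zero =
  let x , Px = countVec-witness (λ x → P (true ∷ x)) pos in true ∷ x , Px
... | suc _ =
  let x , Px = countVec-witness (λ x → P (false ∷ x)) (subst (0 <_) (sym count₀) (s≤s z≤n))
  in false ∷ x , Px

countVec<2^⇒∃false : (P : Z2^ d → Bool) → countVec P < 2 ^ d → ∃ λ x → P x ≡ false
countVec<2^⇒∃false P lt =
  let x , notPx = countVec-witness (λ x → not (P x)) complement-nonempty
  in x , trans (sym (not-involutive (P x))) (cong not notPx)
  where
  complement-nonempty : 0 < countVec (λ x → not (P x))
  complement-nonempty with countVec (λ x → not (P x)) | countVec-complement P
  ... | zero  | eq = ⊥-elim (<-irrefl (trans (sym (+-identityʳ _)) eq) lt)
  ... | suc _ | _  = s≤s z≤n

countVec≡2^⇒all : (P : Z2^ d → Bool) → countVec P ≡ 2 ^ d → ∀ x → P x ≡ true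
countVec≡2^⇒all P full x with P x in Px
... | true  = refl
... | false =
  ⊥-elim (<-irrefl (sym complement-empty) (countVec-hit (λ y → not (P y)) x (cong not Px)))
  where
  complement-empty : countVec (λ y → not (P y)) ≡ 0
  complement-empty = +-cancelˡ-≡ (countVec P) _ 0
    (trans (countVec-complement P) (trans (sym full) (sym (+-identityʳ _))))

countVec-disjoint-∨ : (P Q : Z2^ d → Bool) → (∀ x → P x ∧ Q x ≡ false) →
  countVec (λ x → P x ∨ Q x) ≡ countVec P + countVec Q
countVec-disjoint-∨ P Q disjoint = begin
  countVec (λ x → P x ∨ Q x)
    ≡⟨ +-identityʳ _ ⟨
  countVec (λ x → P x ∨ Q x) + 0
    ≡⟨ cong (countVec (λ x → P x ∨ Q x) +_) (countVec-empty _ disjoint) ⟨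
  countVec (λ x → P x ∨ Q x) + countVec (λ x → P x ∧ Q x)
    ≡⟨ countVec-∨-∧ P Q ⟩
  countVec P + countVec Q
    ∎
  where open ≡-Reasoning

countVec-isZero : ∀ d → countVec {d} isZero ≡ 1
countVec-isZero zero    = refl
countVec-isZero (suc d) =
  cong₂ _+_ (countVec-isZero d) (countVec-empty {d} (λ _ → false) (λ _ → refl))

-- The span of the tail and its translate by the head are disjoint, so adjoining an
-- independent vector doubles the span.
countVec-inSpan : (S : Fin n → Bool) (f : Fin n → Z2^ d) →
  LinIndep S f → countVec (inSpan S f) ≡ 2 ^ count S
countVec-inSpan {zero} {d} S f ind = countVec-isZero d
countVec-inSpan {suc n} S f ind
  with countVec-inSpan (tail S) (tail f) (LinIndep-tail {S = S} {f} ind)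
     | LinIndep-head∉span {S = S} {f} ind | S zero in S₀
... | IH | _     | false = IH
... | IH | head∉ | true  = begin
  countVec (λ x → A (f zero ⊕ x) ∨ A x)
    ≡⟨ countVec-disjoint-∨ (λ x → A (f zero ⊕ x)) A disjoint ⟩
  countVec (λ x → A (f zero ⊕ x)) + countVec A
    ≡⟨ cong (_+ countVec A) (countVec-translate A (f zero)) ⟩
  countVec A + countVec A
    ≡⟨ cong₂ _+_ IH IH ⟩
  2 ^ count (tail S) + 2 ^ count (tail S)
    ≡⟨ 2^[1+d]≡2^d+2^d (count (tail S)) ⟨
  2 ^ suc (count (tail S))
    ∎
  where
  open ≡-Reasoning
  A : Z2^ _ → Bool
  A = inSpan (tail S) (tail f)
  disjoint : ∀ x → A (f zero ⊕ x) ∧ A x ≡ false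
  disjoint x with A (f zero ⊕ x) in shifted∈ | A x in x∈
  ... | false | _     = refl
  ... | true  | false = refl
  ... | true  | true  with () ← trans (sym (head∉ S₀)) (subst (λ z → A z ≡ true) (⊕-cancelʳ (f zero) x)
                                                          (inSpan-⊕ (tail S) (tail f) shifted∈ x∈))

LinIndep⇒Spans : (S : Fin n → Bool) (f : Fin n → Z2^ d) → LinIndep S f → count S ≡ d → Spans S f
LinIndep⇒Spans S f ind |S|≡d w =
  inSpan-sound S f w
    (countVec≡2^⇒all (inSpan S f) (trans (countVec-inSpan S f ind) (cong (2 ^_) |S|≡d)) w)

∃-outside-spans : (S : Fin n → Bool) (f : Fin n → Z2^ d) (T : Fin m → Bool) (g : Fin m → Z2^ d) →
  LinIndep S f → LinIndep T g → count S < d → count T < d →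
  ∃ λ x → inSpan S f x ≡ false × inSpan T g x ≡ false
∃-outside-spans {d = suc d} S f T g indS indT (s≤s |S|≤d) (s≤s |T|≤d) =
  let x , outside = countVec<2^⇒∃false (λ x → P x ∨ Q x) union<2^
  in x , ∨-conicalˡ _ _ outside , ∨-conicalʳ _ _ outside
  where
  P Q : Z2^ _ → Bool
  P = inSpan S f
  Q = inSpan T g
  union<2^ : countVec (λ x → P x ∨ Q x) < 2 ^ suc d
  union<2^ = begin-strict
    countVec (λ x → P x ∨ Q x)
      <⟨ m<m+n _ (countVec-hit (λ x → P x ∧ Q x) 0v (cong₂ _∧_ (inSpan-0v S f) (inSpan-0v T g))) ⟩
    countVec (λ x → P x ∨ Q x) + countVec (λ x → P x ∧ Q x)
      ≡⟨ countVec-∨-∧ P Q ⟩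
    countVec P + countVec Q
      ≡⟨ cong₂ _+_ (countVec-inSpan S f indS) (countVec-inSpan T g indT) ⟩
    2 ^ count S + 2 ^ count T
      ≤⟨ +-mono-≤ (^-monoʳ-≤ 2 |S|≤d) (^-monoʳ-≤ 2 |T|≤d) ⟩
    2 ^ d + 2 ^ d
      ≡⟨ 2^[1+d]≡2^d+2^d d ⟨
    2 ^ suc d
      ∎
    where open ≤-Reasoning

count-mono : (S T : Fin n → Bool) → (∀ k → S k ≡ true → T k ≡ true) → count S ≤ count T
count-mono {zero}  S T S⊆T = z≤n
count-mono {suc n} S T S⊆T with S zero in S₀ | T zero in T₀
... | false | false = count-mono (tail S) (tail T) (λ k → S⊆T (suc k))
... | false | true  = m≤n⇒m≤1+n (count-mono (tail S) (tail T) (λ k → S⊆T (suc k)))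
... | true  | true  = s≤s (count-mono (tail S) (tail T) (λ k → S⊆T (suc k)))
... | true  | false with () ← trans (sym (S⊆T zero S₀)) T₀

count-< : (S T : Fin n → Bool) → (∀ k → S k ≡ true → T k ≡ true) →
  (j : Fin n) → S j ≡ false → T j ≡ true → count S < count T
count-< S T S⊆T zero Sj Tj rewrite Sj | Tj =
  s≤s (count-mono (tail S) (tail T) (λ k → S⊆T (suc k)))
count-< S T S⊆T (suc j) Sj Tj with S zero in S₀ | T zero in T₀
... | false | false = count-< (tail S) (tail T) (λ k → S⊆T (suc k)) j Sj Tj
... | false | true  = m≤n⇒m≤1+n (count-< (tail S) (tail T) (λ k → S⊆T (suc k)) j Sj Tj)
... | true  | true  = s≤s (count-< (tail S) (tail T) (λ k → S⊆T (suc k)) j Sj Tj)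
... | true  | false with () ← trans (sym (S⊆T zero S₀)) T₀

SameEdge : Fin n → Fin n → Fin n → Fin n → Set
SameEdge i j a b = (a ≡ i × b ≡ j) ⊎ (a ≡ j × b ≡ i)

SameEdge-sym : {i j a b : Fin n} → SameEdge i j a b → SameEdge i j b a
SameEdge-sym (inj₁ (a≡i , b≡j)) = inj₂ (b≡j , a≡i)
SameEdge-sym (inj₂ (a≡j , b≡i)) = inj₁ (b≡i , a≡j)

sameEdge? : (i j a b : Fin n) → Dec (SameEdge i j a b)
sameEdge? i j a b = ((a ≟ i) ×-dec (b ≟ j)) ⊎-dec ((a ≟ j) ×-dec (b ≟ i))

setSym : {A : Set} → (Fin n → Fin n → A) → Fin n → Fin n → A → Fin n → Fin n → A
setSym M i j y =
  updateAt (updateAt M i (λ row → updateAt row j (λ _ → y))) j (λ row → updateAt row i (λ _ → y))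

module _ {A : Set} {M : Fin n → Fin n → A} {i j : Fin n} {y : A} (i≢j : i ≢ j) where

  setSym-rowˡ : setSym M i j y i ≡ updateAt (M i) j (λ _ → y)
  setSym-rowˡ = trans (updateAt-minimal i j _ i≢j) (updateAt-updates i M)

  setSym-rowʳ : setSym M i j y j ≡ updateAt (M j) i (λ _ → y)
  setSym-rowʳ = trans (updateAt-updates j _)
                      (cong (λ row → updateAt row i (λ _ → y)) (updateAt-minimal j i M (≢-sym i≢j)))

  setSym-row : {u : Fin n} → u ≢ i → u ≢ j → setSym M i j y u ≡ M u
  setSym-row {u} u≢i u≢j = trans (updateAt-minimal u j _ u≢j) (updateAt-minimal u i M u≢i)

  setSym-ij : setSym M i j y i j ≡ y
  setSym-ij = trans (cong-app setSym-rowˡ j) (updateAt-updates j (M i))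

  setSym-ji : setSym M i j y j i ≡ y
  setSym-ji = trans (cong-app setSym-rowʳ i) (updateAt-updates i (M j))

  setSym-elsewhere : {a b : Fin n} → ¬ SameEdge i j a b → setSym M i j y a b ≡ M a b
  setSym-elsewhere {a} {b} ¬ab with a ≟ i | a ≟ j
  ... | yes refl | _ =
    trans (cong-app setSym-rowˡ b) (updateAt-minimal b j (M i) (λ b≡j → ¬ab (inj₁ (refl , b≡j))))
  ... | no _ | yes refl =
    trans (cong-app setSym-rowʳ b) (updateAt-minimal b i (M j) (λ b≡i → ¬ab (inj₂ (refl , b≡i))))
  ... | no a≢i | no a≢j = cong-app (setSym-row a≢i a≢j) b

  setSym-elim : (P : Fin n → Fin n → A → Set) → P i j y → P j i y →
    (∀ a b → ¬ SameEdge i j a b → P a b (M a b)) → ∀ a b → P a b (setSym M i j y a b)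
  setSym-elim P Pij Pji Pelse a b with sameEdge? i j a b
  ... | yes (inj₁ (refl , refl)) = subst (P i j) (sym setSym-ij) Pij
  ... | yes (inj₂ (refl , refl)) = subst (P j i) (sym setSym-ji) Pji
  ... | no ¬ab = subst (P a b) (sym (setSym-elsewhere ¬ab)) (Pelse a b ¬ab)

  setSym-sym : ∀ a b → (¬ SameEdge i j a b → M a b ≡ M b a) →
    setSym M i j y a b ≡ setSym M i j y b a
  setSym-sym = setSym-elim
    (λ a b v → (¬ SameEdge i j a b → M a b ≡ M b a) → v ≡ setSym M i j y b a)
    (λ _ → sym setSym-ji)
    (λ _ → sym setSym-ij)
    (λ a b ¬ab Mab≡Mba → trans (Mab≡Mba ¬ab) (sym (setSym-elsewhere (¬ab ∘ SameEdge-sym))))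

record PartialLabelling (G : Graph n) (d : ℕ) : Set where
  field
    labelled     : Fin n → Fin n → Bool
    label        : Fin n → Fin n → Z2^ d
    labelled-sym : ∀ a b → labelled a b ≡ labelled b a
    labelled⊆adj : ∀ a b → labelled a b ≡ true → adj G a b ≡ true
    label-sym    : ∀ a b → labelled a b ≡ true → label a b ≡ label b a
    label-indep  : ∀ u → LinIndep (labelled u) (label u)

open PartialLabelling

record _≼_ {G : Graph n} (L L′ : PartialLabelling G d) : Set where
  field
    labelled-⊆ : ∀ a b → labelled L a b ≡ true → labelled L′ a b ≡ true
    label-kept : ∀ a b → labelled L a b ≡ true → label L′ a b ≡ label L a b

open _≼_

≼-refl : {G : Graph n} {L : PartialLabelling G d} → L ≼ L
≼-refl = record { labelled-⊆ = λ _ _ ab∈ → ab∈ ; label-kept = λ _ _ _ → refl }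

≼-trans : {G : Graph n} {L₁ L₂ L₃ : PartialLabelling G d} → L₁ ≼ L₂ → L₂ ≼ L₃ → L₁ ≼ L₃
≼-trans L₁≼L₂ L₂≼L₃ = record
  { labelled-⊆ = λ a b ab∈ → labelled-⊆ L₂≼L₃ a b (labelled-⊆ L₁≼L₂ a b ab∈)
  ; label-kept = λ a b ab∈ →
      trans (label-kept L₂≼L₃ a b (labelled-⊆ L₁≼L₂ a b ab∈)) (label-kept L₁≼L₂ a b ab∈)
  }

add-edge : {G : Graph n} (L : PartialLabelling G d) {i j : Fin n} →
  adj G i j ≡ true → labelled L i j ≡ false → (x : Z2^ d) →
  inSpan (labelled L i) (label L i) x ≡ false → inSpan (labelled L j) (label L j) x ≡ false →
  ∃ λ L′ → L ≼ L′ × labelled L′ i j ≡ true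
add-edge {G = G} L {i} {j} i~j ij∉L x x∉i x∉j = L′ , L≼L′ , setSym-ij i≢j
  where
  i≢j : i ≢ j
  i≢j refl with () ← trans (sym i~j) (irrefl G i)

  ji∉L : labelled L j i ≡ false
  ji∉L = trans (labelled-sym L j i) ij∉L

  labelled′ : Fin _ → Fin _ → Bool
  labelled′ = setSym (labelled L) i j true

  label′ : Fin _ → Fin _ → Z2^ _
  label′ = setSym (label L) i j x

  indep′ : ∀ u → LinIndep (labelled′ u) (label′ u)
  indep′ u with u ≟ i | u ≟ j
  ... | yes refl | _ = subst₂ LinIndep (sym (setSym-rowˡ i≢j)) (sym (setSym-rowˡ i≢j))
                               (LinIndep-insert (label-indep L i) ij∉L x∉i)
  ... | no _ | yes refl = subst₂ LinIndep (sym (setSym-rowʳ i≢j)) (sym (setSym-rowʳ i≢j))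
                                   (LinIndep-insert (label-indep L j) ji∉L x∉j)
  ... | no u≢i | no u≢j = subst₂ LinIndep (sym (setSym-row i≢j u≢i u≢j)) (sym (setSym-row i≢j u≢i u≢j))
                                   (label-indep L u)

  L′ : PartialLabelling G _
  L′ = record
    { labelled     = labelled′
    ; label        = label′
    ; labelled-sym = λ a b → setSym-sym i≢j a b (λ _ → labelled-sym L a b)
    ; labelled⊆adj = setSym-elim i≢j (λ a b e → e ≡ true → adj G a b ≡ true)
                       (λ _ → i~j) (λ _ → trans (adj-sym G j i) i~j) (λ a b _ → labelled⊆adj L a b)
    ; label-sym    = λ a b ab∈ → setSym-sym i≢j a b
                       (λ ¬ab → label-sym L a b (trans (sym (setSym-elsewhere i≢j ¬ab)) ab∈))
    ; label-indep  = indep′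
    }

  L≼L′ : L ≼ L′
  L≼L′ = record
    { labelled-⊆ = setSym-elim i≢j (λ a b e → labelled L a b ≡ true → e ≡ true)
                     (λ _ → refl) (λ _ → refl) (λ _ _ _ ab∈ → ab∈)
    ; label-kept = setSym-elim i≢j (λ a b v → labelled L a b ≡ true → v ≡ label L a b)
                     (λ ij∈L → contradiction (trans (sym ij∈L) ij∉L) λ ())
                     (λ ji∈L → contradiction (trans (sym ji∈L) ji∉L) λ ())
                     (λ _ _ _ _ → refl)
    }

unlabelled-edge⇒count< : {G : Graph n} → Regular d G → (L : PartialLabelling G d) {i j : Fin n} →
  adj G i j ≡ true → labelled L i j ≡ false → count (labelled L i) < d
unlabelled-edge⇒count< {G = G} reg L {i} {j} i~j ij∉L =
  subst (count (labelled L i) <_) (reg i)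
        (count-< (labelled L i) (adj G i) (labelled⊆adj L i) j ij∉L i~j)

cover-edge : {G : Graph n} → Regular d G → (L : PartialLabelling G d) (i j : Fin n) →
  ∃ λ L′ → L ≼ L′ × (adj G i j ≡ true → labelled L′ i j ≡ true)
cover-edge {G = G} reg L i j with adj G i j in i~j | labelled L i j in ij∈L?
... | false | _     = L , ≼-refl , λ ()
... | true  | true  = L , ≼-refl , λ _ → ij∈L?
... | true  | false =
  let x , x∉i , x∉j = ∃-outside-spans (labelled L i) (label L i) (labelled L j) (label L j)
                        (label-indep L i) (label-indep L j)
                        (unlabelled-edge⇒count< reg L i~j ij∈L?) (unlabelled-edge⇒count< reg L j~i ji∉L)
      L′ , L≼L′ , ij∈L′ = add-edge L i~j ij∈L? x x∉i x∉j
  in L′ , L≼L′ , λ _ → ij∈L′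
  where
  j~i : adj G j i ≡ true
  j~i = trans (adj-sym G j i) i~j
  ji∉L : labelled L j i ≡ false
  ji∉L = trans (labelled-sym L j i) ij∈L?

cover-edges : {G : Graph n} → Regular d G → (L : PartialLabelling G d) (ps : List (Fin n × Fin n)) →
  ∃ λ L′ → L ≼ L′ × (∀ {i j} → (i , j) ∈ ps → adj G i j ≡ true → labelled L′ i j ≡ true)
cover-edges reg L [] = L , ≼-refl , λ ()
cover-edges reg L ((i , j) ∷ ps) =
  let L₁ , L≼L₁ , ij∈L₁ = cover-edge reg L i j
      L₂ , L₁≼L₂ , ps⊆L₂ = cover-edges reg L₁ ps
  in L₂ , ≼-trans L≼L₁ L₁≼L₂ , λ { (here refl) i~j → labelled-⊆ L₁≼L₂ i j (ij∈L₁ i~j)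
                                  ; (there p∈)      → ps⊆L₂ p∈
                                  }

saturate : {G : Graph n} → Regular d G → (L : PartialLabelling G d) →
  ∃ λ L′ → L ≼ L′ × (∀ i j → labelled L′ i j ≡ adj G i j)
saturate {n = n} {G = G} reg L =
  let L′ , L≼L′ , covered = cover-edges reg L (cartesianProduct (allFin n) (allFin n))
  in L′ , L≼L′ , saturated L′ (λ {i} {j} → covered (∈-cartesianProduct⁺ (∈-allFin i) (∈-allFin j)))
  where
  saturated : (L′ : PartialLabelling G _) → (∀ {i j} → adj G i j ≡ true → labelled L′ i j ≡ true) →
    ∀ i j → labelled L′ i j ≡ adj G i j
  saturated L′ covers i j with adj G i j in i~j | labelled L′ i j in ij∈L′
  ... | true  | true  = refl
  ... | false | false = refl
  ... | true  | false with () ← trans (sym (covers i~j)) ij∈L′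
  ... | false | true  with () ← trans (sym (labelled⊆adj L′ i j ij∈L′)) i~j

saturated⇒basis : {G : Graph n} → Regular d G → (L : PartialLabelling G d) →
  (∀ u k → labelled L u k ≡ adj G u k) → ∀ u → IsBasis (adj G u) (label L u)
saturated⇒basis {G = G} reg L L≡adj u = indep , LinIndep⇒Spans (adj G u) (label L u) indep (reg u)
  where
  indep : LinIndep (adj G u) (label L u)
  indep = LinIndep-cong (L≡adj u) (label-indep L u)

lemma2p2 : (n d : ℕ) (G : Graph n) → Regular d G →
    (inE' : Fin n → Fin n → Bool) →
    (∀ i j → inE' i j ≡ inE' j i) →
    (∀ i j → inE' i j ≡ true → adj G i j ≡ true) →
    (v : Fin n → Fin n → Z2^ d) →
    (∀ i j → inE' i j ≡ true → v i j ≡ v j i) →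
    (∀ u → LinIndep (λ j → adj G u j ∧ inE' u j) (v u)) →
    ∃ λ (w : Fin n → Fin n → Z2^ d) →
      (∀ i j → adj G i j ≡ true → w i j ≡ w j i) ×
      (∀ i j → inE' i j ≡ true → w i j ≡ v i j) ×
      (∀ u → IsBasis (adj G u) (w u))
lemma2p2 n d G reg inE' inE'-sym inE'⊆adj v v-sym v-indep =
  let L , L₀≼L , L≡adj = saturate reg L₀
  in label L
   , (λ i j i~j → label-sym L i j (trans (L≡adj i j) i~j))
   , label-kept L₀≼L
   , saturated⇒basis reg L L≡adj
  where
  adj∧inE'≡inE' : ∀ u k → adj G u k ∧ inE' u k ≡ inE' u k
  adj∧inE'≡inE' u k with inE' u k in uk∈
  ... | true  = cong (_∧ true) (inE'⊆adj u k uk∈)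
  ... | false = ∧-zeroʳ (adj G u k)

  L₀ : PartialLabelling G d
  L₀ = record
    { labelled     = inE'
    ; label        = v
    ; labelled-sym = inE'-sym
    ; labelled⊆adj = inE'⊆adj
    ; label-sym    = v-sym
    ; label-indep  = λ u → LinIndep-cong (adj∧inE'≡inE' u) (v-indep u)
    }
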